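{- For all integers $n \geq 0$, \[ P(n+1) = \sum_{i \geq 0} a_{2i}(2i+1,n-4i). \]
   Context: The Pell numbers are defined by $P(0)=0$, $P(1)=1$, $P(n)=2P(n-1)+P(n-2)$ for $n\ge2$. For integers $r\ge0$ and $n\ge0$, $a(r,n)$ is the number of ways to tile a $1\times(n+r)$ grid using $r$ indistinguishable red $1\times1$ squares and white tiles of arbitrary positive integer lengths of total length $n$ (order matters); $a(r,n)=0$ for $n<0$. Set $a_0(r,n)=a(r,n)$ and $a_s(r,n)=\sum_{i=0}^n a_{s-1}(r,i)$ for $s\ge1$ ($0$ for $n<0$). -}

module Defs where

open import Data.Nat using (ℕ; zero; suc; _+_; _*_; _∸_)
open import Data.Integer using (ℤ; +_; -[1+_])
open import Data.List using (List; []; _∷_; _++_; map; concatMap; length; upTo)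
open import Data.Nat.ListAction using (sum)

P : ℕ → ℕ
P zero = 0
P (suc zero) = 1
P (suc (suc n)) = 2 * P (suc n) + P n

-- A piece of a tiling: a red 1×1 square, or a white tile of length (suc k).
data Piece : Set where
  red   : Piece
  white : ℕ → Piece

-- Enumeration of all tilings (ordered lists of pieces) using exactly r red
-- squares and white tiles of total length n, by choosing the first piece.
-- The fuel argument only ensures structural termination; fuel r + n suffices
-- since every piece has length ≥ 1.
tilingsF : ℕ → ℕ → ℕ → List (List Piece)
tilingsF fuel    zero    zero    = [] ∷ []
tilingsF zero    (suc r) n       = []
tilingsF zero    zero    (suc n) = []
tilingsF (suc f) r       n       = reds r ++ whites
  where
  reds : ℕ → List (List Piece)
  reds zero    = []
  reds (suc r′) = map (red ∷_) (tilingsF f r′ n)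
  whites : List (List Piece)
  whites = concatMap (λ k → map (white k ∷_) (tilingsF f r (n ∸ suc k))) (upTo n)

tilings : ℕ → ℕ → List (List Piece)
tilings r n = tilingsF (r + n) r n

-- a(r,n): the number of such tilings of a 1×(n+r) grid
a : ℕ → ℕ → ℕ
a r n = length (tilings r n)

aₛ : ℕ → ℕ → ℕ → ℕ
aₛ zero    r n = a r n
aₛ (suc s) r n = sum (map (aₛ s r) (upTo (suc n)))

aₛℤ : ℕ → ℕ → ℤ → ℕ
aₛℤ s r (+ n)      = aₛ s r n
aₛℤ s r -[1+ n ]   = 0

module Submission where

-- Integer sequences are read as power series; sh is multiplication by x, and
-- D = 1 − x, E = 1 − 2x, Q = 1 − 2x − x² act as operators, with the prefix-sum
-- operator Σ inverse to D.  The Pell sequence also satisfies Q P = 1, and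
--    Q is injective.

open import Defs

module FiniteSums where
  open import Data.Nat using (ℕ; zero; suc; _+_; _<_; z≤n; s≤s)
  open import Data.List using (map; applyUpTo; upTo)
  open import Data.Nat.ListAction using (sum)
  open import Relation.Binary.PropositionalEquality using (_≡_; refl; cong; cong₂)
  open import Function using (_∘_)

  ∑< : ℕ → (ℕ → ℕ) → ℕ
  ∑< zero    g = 0
  ∑< (suc n) g = g 0 + ∑< n (g ∘ suc)

  ∑<-cong : ∀ n {g h : ℕ → ℕ} → (∀ k → k < n → g k ≡ h k) → ∑< n g ≡ ∑< n h
  ∑<-cong zero    eq = refl
  ∑<-cong (suc n) eq =
    cong₂ _+_ (eq 0 (s≤s z≤n)) (∑<-cong n (λ k k<n → eq (suc k) (s≤s k<n)))

  sum-upTo : ∀ (g : ℕ → ℕ) n → sum (map g (upTo n)) ≡ ∑< n g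
  sum-upTo g = sum-applyUpTo (λ k → k)
    where
    sum-applyUpTo : ∀ (f : ℕ → ℕ) n → sum (map g (applyUpTo f n)) ≡ ∑< n (g ∘ f)
    sum-applyUpTo f zero    = refl
    sum-applyUpTo f (suc n) = cong (g (f 0) +_) (sum-applyUpTo (f ∘ suc) n)

module TilingCounts where
  open FiniteSums
  open import Data.Nat using (ℕ; zero; suc; _+_; _*_; _∸_; _≤_; _<_; s≤s)
  open import Data.Nat.Properties
    using (+-suc; +-identityʳ; ≤-trans; ≤-refl; ≤-reflexive; +-monoʳ-≤; n≤1+n; m∸n≤m)
  open import Data.Nat.Tactic.RingSolver using (solve-∀)
  open import Data.List using (List; []; _∷_; map; concatMap; length; upTo)
  open import Data.List.Properties using (length-++; length-map)
  open import Data.Nat.ListAction using (sum)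
  open import Relation.Binary.PropositionalEquality
    using (_≡_; refl; sym; trans; cong; cong₂; module ≡-Reasoning)
  open import Function using (_∘_)
  open ≡-Reasoning

  length-concatMap : ∀ {A B : Set} (h : A → List B) xs →
    length (concatMap h xs) ≡ sum (map (length ∘ h) xs)
  length-concatMap h []       = refl
  length-concatMap h (x ∷ xs) =
    trans (length-++ (h x)) (cong (length (h x) +_) (length-concatMap h xs))

  count : ℕ → ℕ → ℕ → ℕ
  count fuel r n = length (tilingsF fuel r n)

  whiteFirst : ℕ → ℕ → ℕ → ℕ
  whiteFirst fuel r n = ∑< n (λ k → count fuel r (n ∸ suc k))

  count-whiteFirst : ∀ f r n →
    length (concatMap (λ k → map (white k ∷_) (tilingsF f r (n ∸ suc k))) (upTo n))
      ≡ whiteFirst f r n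
  count-whiteFirst f r n = begin
      length (concatMap tail (upTo n))
    ≡⟨ length-concatMap tail (upTo n) ⟩
      sum (map (length ∘ tail) (upTo n))
    ≡⟨ sum-upTo (length ∘ tail) n ⟩
      ∑< n (length ∘ tail)
    ≡⟨ ∑<-cong n (λ k _ → length-map (white k ∷_) (tilingsF f r (n ∸ suc k))) ⟩
      whiteFirst f r n
    ∎
    where
    tail : ℕ → List (List Piece)
    tail k = map (white k ∷_) (tilingsF f r (n ∸ suc k))

  count-red : ∀ f r n → count (suc f) (suc r) n ≡ count f r n + whiteFirst f (suc r) n
  count-red f r n = trans (length-++ (map (red ∷_) (tilingsF f r n)))
    (cong₂ _+_ (length-map (red ∷_) (tilingsF f r n)) (count-whiteFirst f (suc r) n))

  count-white : ∀ f n → count (suc f) 0 (suc n) ≡ whiteFirst f 0 (suc n)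
  count-white f n = count-whiteFirst f 0 (suc n)

  after-white : ∀ r n k → k < n → suc r + (n ∸ suc k) ≤ r + n
  after-white r (suc n) zero    _         = ≤-reflexive (sym (+-suc r n))
  after-white r (suc n) (suc k) (s≤s k<n) =
    ≤-trans (after-white r n k k<n) (+-monoʳ-≤ r (n≤1+n n))

  -- Every piece has length ≥ 1, so fuel r + n already enumerates all tilings.
  count-fuel : ∀ f g r n → r + n ≤ f → r + n ≤ g → count f r n ≡ count g r n
  count-fuel f g zero zero _ _ = refl
  count-fuel (suc f) (suc g) (suc r) n (s≤s r+n≤f) (s≤s r+n≤g) = begin
      count (suc f) (suc r) n
    ≡⟨ count-red f r n ⟩
      count f r n + whiteFirst f (suc r) n
    ≡⟨ cong₂ _+_ (count-fuel f g r n r+n≤f r+n≤g) (∑<-cong n (λ k k<n →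
         count-fuel f g (suc r) (n ∸ suc k)
           (≤-trans (after-white r n k k<n) r+n≤f) (≤-trans (after-white r n k k<n) r+n≤g))) ⟩
      count g r n + whiteFirst g (suc r) n
    ≡⟨ count-red g r n ⟨
      count (suc g) (suc r) n
    ∎
  count-fuel (suc f) (suc g) zero (suc n) (s≤s n≤f) (s≤s n≤g) = begin
      count (suc f) 0 (suc n)
    ≡⟨ count-white f n ⟩
      whiteFirst f 0 (suc n)
    ≡⟨ ∑<-cong (suc n) (λ k _ →
         count-fuel f g 0 (n ∸ k) (≤-trans (m∸n≤m n k) n≤f) (≤-trans (m∸n≤m n k) n≤g)) ⟩
      whiteFirst g 0 (suc n)
    ≡⟨ count-white g n ⟨
      count (suc g) 0 (suc n)
    ∎

  -- W r n: tilings with r red squares and white length n that start with a white tile.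
  W : ℕ → ℕ → ℕ
  W r n = ∑< n (λ k → a r (n ∸ suc k))

  a-red : ∀ r n → a (suc r) n ≡ a r n + W (suc r) n
  a-red r n = trans (count-red (r + n) r n) (cong (a r n +_) (∑<-cong n (λ k k<n →
    count-fuel (r + n) (suc r + (n ∸ suc k)) (suc r) (n ∸ suc k) (after-white r n k k<n) ≤-refl)))

  a-white : ∀ n → a 0 (suc n) ≡ W 0 (suc n)
  a-white n = trans (count-white n n) (∑<-cong (suc n) (λ k _ →
    count-fuel n (n ∸ k) 0 (n ∸ k) (m∸n≤m n k) ≤-refl))

  -- The recurrences behind ∑ₙ a(r, n) xⁿ = ((1 − x)/(1 − 2x))^(r+1):
  -- a(r+1, 0) = a(r, 0), a(r+1, n+1) − 2a(r+1, n) = a(r, n+1) − a(r, n),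
  -- and a(0, n+2) = 2a(0, n+1).
  a-red-zero : ∀ r → a (suc r) 0 ≡ a r 0
  a-red-zero r = trans (a-red r 0) (+-identityʳ (a r 0))

  a-step : ∀ r n → a (suc r) (suc n) + a r n ≡ a r (suc n) + 2 * a (suc r) n
  a-step r n = begin
      a (suc r) (suc n) + a r n
    ≡⟨ cong (_+ a r n) (a-red r (suc n)) ⟩
      a r (suc n) + (a (suc r) n + W (suc r) n) + a r n
    ≡⟨ regroup (a r (suc n)) (a (suc r) n) (W (suc r) n) (a r n) ⟩
      a r (suc n) + a (suc r) n + (a r n + W (suc r) n)
    ≡⟨ cong (a r (suc n) + a (suc r) n +_) (sym (a-red r n)) ⟩
      a r (suc n) + a (suc r) n + a (suc r) n
    ≡⟨ double (a r (suc n)) (a (suc r) n) ⟩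
      a r (suc n) + 2 * a (suc r) n
    ∎
    where
    regroup : ∀ x y w z → x + (y + w) + z ≡ x + y + (z + w)
    regroup = solve-∀
    double : ∀ x y → x + y + y ≡ x + 2 * y
    double = solve-∀

  a0-step : ∀ n → a 0 (suc (suc n)) ≡ 2 * a 0 (suc n)
  a0-step n = begin
      a 0 (suc (suc n))
    ≡⟨ a-white (suc n) ⟩
      a 0 (suc n) + W 0 (suc n)
    ≡⟨ cong (a 0 (suc n) +_) (trans (sym (a-white n)) (sym (+-identityʳ (a 0 (suc n))))) ⟩
      2 * a 0 (suc n)
    ∎

module ShiftOperators where
  open FiniteSums using (∑<; sum-upTo)
  import Data.Nat as ℕ
  open ℕ using (ℕ; zero; suc; _≤_; _<_; z≤n; s≤s)
  open import Data.Nat.Properties using (<⇒≤; ≤-refl; ≤-trans; n≤1+n)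
  open import Data.Integer using (ℤ; +_; -_; _+_; _-_; _*_)
  import Data.Integer.Properties as ℤP
  open import Data.Integer.Tactic.RingSolver using (solve-∀)
  open import Algebra.Properties.AbelianGroup ℤP.+-0-abelianGroup using (∙-cancelʳ)
  open import Data.List using (map; upTo)
  open import Data.Nat.ListAction using (sum)
  open import Relation.Binary.PropositionalEquality
    using (_≡_; _≗_; refl; sym; trans; cong; cong₂; module ≡-Reasoning)
  open import Function using (_∘_)
  open ≡-Reasoning

  Seq : Set
  Seq = ℕ → ℤ

  δ : Seq
  δ zero    = + 1
  δ (suc n) = + 0

  sh : Seq → Seq
  sh f zero    = + 0
  sh f (suc n) = f n

  shⁿ : ℕ → Seq → Seq
  shⁿ zero    f = f
  shⁿ (suc k) f = sh (shⁿ k f)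

  D : Seq → Seq
  D f n = f n - sh f n

  E : Seq → Seq
  E f n = f n - + 2 * sh f n

  Q : Seq → Seq
  Q f n = f n - + 2 * sh f n - sh (sh f) n

  D² : Seq → Seq
  D² f = D (D f)

  E² : Seq → Seq
  E² f = E (E f)

  ∑ℤ< : ℕ → (ℕ → ℤ) → ℤ
  ∑ℤ< zero    g = + 0
  ∑ℤ< (suc n) g = g 0 + ∑ℤ< n (g ∘ suc)

  Σ : Seq → Seq
  Σ f n = ∑ℤ< (suc n) f

  sum-upTo-ℤ : ∀ (g : ℕ → ℕ) N → + sum (map g (upTo N)) ≡ ∑ℤ< N (λ k → + g k)
  sum-upTo-ℤ g N = trans (cong +_ (sum-upTo g N)) (cast g N)
    where
    cast : ∀ (g : ℕ → ℕ) N → + ∑< N g ≡ ∑ℤ< N (λ k → + g k)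
    cast g zero    = refl
    cast g (suc N) = trans (ℤP.pos-+ (g 0) (∑< N (g ∘ suc))) (cong (λ s → + g 0 + s) (cast (g ∘ suc) N))

  ∑ℤ<-cong : ∀ N {g h : ℕ → ℤ} → g ≗ h → ∑ℤ< N g ≡ ∑ℤ< N h
  ∑ℤ<-cong zero    eq = refl
  ∑ℤ<-cong (suc N) eq = cong₂ _+_ (eq 0) (∑ℤ<-cong N (eq ∘ suc))

  ∑ℤ<-snoc : ∀ N (g : ℕ → ℤ) → ∑ℤ< (suc N) g ≡ ∑ℤ< N g + g N
  ∑ℤ<-snoc zero    g = ℤP.+-comm (g 0) (+ 0)
  ∑ℤ<-snoc (suc N) g =
    trans (cong (λ s → g 0 + s) (∑ℤ<-snoc N (g ∘ suc))) (sym (ℤP.+-assoc (g 0) _ _))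

  ∑ℤ<-linear : ∀ N (c : ℤ) (g h : ℕ → ℤ) →
    ∑ℤ< N (λ i → g i - c * h i) ≡ ∑ℤ< N g - c * ∑ℤ< N h
  ∑ℤ<-linear zero    c g h = zero-case c
    where
    zero-case : ∀ c → + 0 ≡ + 0 - c * + 0
    zero-case = solve-∀
  ∑ℤ<-linear (suc N) c g h =
    trans (cong (λ s → g 0 - c * h 0 + s) (∑ℤ<-linear N c (g ∘ suc) (h ∘ suc)))
          (step (g 0) (h 0) (∑ℤ< N (g ∘ suc)) (∑ℤ< N (h ∘ suc)) c)
    where
    step : ∀ x y X Y c → x - c * y + (X - c * Y) ≡ x + X - c * (y + Y)
    step = solve-∀

  ∑ℤ<-zero : ∀ N (g : ℕ → ℤ) → (∀ i → g i ≡ + 0) → ∑ℤ< N g ≡ + 0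
  ∑ℤ<-zero zero    g _     = refl
  ∑ℤ<-zero (suc N) g zeros = cong₂ _+_ (zeros 0) (∑ℤ<-zero N (g ∘ suc) (zeros ∘ suc))

  ∑ℤ<-vanish : ∀ {M N} (g : ℕ → ℤ) → M ≤ N → (∀ i → M ≤ i → g i ≡ + 0) →
    ∑ℤ< N g ≡ ∑ℤ< M g
  ∑ℤ<-vanish {zero}  {N}     g _         zeros = ∑ℤ<-zero N g (λ i → zeros i z≤n)
  ∑ℤ<-vanish {suc M} {suc N} g (s≤s M≤N) zeros =
    cong (λ s → g 0 + s) (∑ℤ<-vanish (g ∘ suc) M≤N (λ i M≤i → zeros (suc i) (s≤s M≤i)))

  sh-cong : ∀ {f g} → f ≗ g → sh f ≗ sh g
  sh-cong eq zero    = refl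
  sh-cong eq (suc n) = eq n

  shⁿ-cong : ∀ k {f g} → f ≗ g → shⁿ k f ≗ shⁿ k g
  shⁿ-cong zero    eq = eq
  shⁿ-cong (suc k) eq = sh-cong (shⁿ-cong k eq)

  D-cong : ∀ {f g} → f ≗ g → D f ≗ D g
  D-cong eq n = cong₂ _-_ (eq n) (sh-cong eq n)

  E-cong : ∀ {f g} → f ≗ g → E f ≗ E g
  E-cong eq n = cong₂ (λ x y → x - + 2 * y) (eq n) (sh-cong eq n)

  E²-cong : ∀ {f g} → f ≗ g → E² f ≗ E² g
  E²-cong eq = E-cong (E-cong eq)

  Σ-cong : ∀ {f g} → f ≗ g → Σ f ≗ Σ g
  Σ-cong eq n = ∑ℤ<-cong (suc n) eq

  sub-cancelʳ : ∀ {x u} y → x - y ≡ u - y → x ≡ u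
  sub-cancelʳ {x} {u} y = ∙-cancelʳ (- y) x u

  -- D and Q are injective: f n is recovered from (D f) n, resp. (Q f) n,
  -- and the earlier values of f.
  D-injective : ∀ {f g} → D f ≗ D g → f ≗ g
  D-injective {f} {g} eq n =
    sub-cancelʳ (sh f n) (trans (eq n) (cong (λ y → g n - y) (sym (earlier n))))
    where
    earlier : ∀ n → sh f n ≡ sh g n
    earlier zero    = refl
    earlier (suc m) = D-injective {f} {g} eq m

  Q-injective : ∀ {f g} → Q f ≗ Q g → f ≗ g
  Q-injective {f} {g} eq n = sub-cancelʳ (+ 2 * sh f n) (sub-cancelʳ (sh (sh f) n) (begin
      f n - + 2 * sh f n - sh (sh f) n
    ≡⟨ eq n ⟩
      g n - + 2 * sh g n - sh (sh g) n
    ≡⟨ cong₂ (λ y z → g n - + 2 * y - z) (sym (earlier n)) (sym (earlier₂ n)) ⟩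
      g n - + 2 * sh f n - sh (sh f) n
    ∎))
    where
    earlier : ∀ n → sh f n ≡ sh g n
    earlier zero    = refl
    earlier (suc m) = Q-injective {f} {g} eq m
    earlier₂ : ∀ n → sh (sh f) n ≡ sh (sh g) n
    earlier₂ zero    = refl
    earlier₂ (suc m) = earlier m

  DΣ : ∀ f → D (Σ f) ≗ f
  DΣ f zero    = drop-zero (f 0)
    where
    drop-zero : ∀ x → x + + 0 - + 0 ≡ x
    drop-zero = solve-∀
  DΣ f (suc n) = trans (cong (λ s → s - Σ f n) (∑ℤ<-snoc (suc n) f)) (add-sub (Σ f n) (f (suc n)))
    where
    add-sub : ∀ x y → x + y - x ≡ y
    add-sub = solve-∀

  ΣD : ∀ f → Σ (D f) ≗ f
  ΣD f = D-injective (DΣ (D f))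

  ΣΣD² : ∀ f → Σ (Σ (D² f)) ≗ f
  ΣΣD² f n = trans (Σ-cong (ΣD (D f)) n) (ΣD f n)

  swap-DE : ∀ x y z → x - + 2 * y - (y - + 2 * z) ≡ x - y - + 2 * (y - z)
  swap-DE = solve-∀

  DE : ∀ f → D (E f) ≗ E (D f)
  DE f zero          = swap-DE (f 0) (+ 0) (+ 0)
  DE f (suc zero)    = swap-DE (f 1) (f 0) (+ 0)
  DE f (suc (suc n)) = swap-DE (f (suc (suc n))) (f (suc n)) (f n)

  -- Since D commutes with E and is injective, so does its inverse Σ.
  EΣ : ∀ f → E (Σ f) ≗ Σ (E f)
  EΣ f = D-injective (λ n → trans (DE (Σ f) n) (trans (E-cong (DΣ f) n) (sym (DΣ (E f) n))))

  E²Σ : ∀ f → E² (Σ f) ≗ Σ (E² f)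
  E²Σ f n = trans (E-cong (EΣ f) n) (EΣ (E f) n)

  E-sh : ∀ f → E (sh f) ≗ sh (E f)
  E-sh f zero    = refl
  E-sh f (suc n) = refl

  E²-shⁿ : ∀ k f → E² (shⁿ k f) ≗ shⁿ k (E² f)
  E²-shⁿ k f n = trans (E-cong (E-shⁿ k f) n) (E-shⁿ k (E f) n)
    where
    E-shⁿ : ∀ k f → E (shⁿ k f) ≗ shⁿ k (E f)
    E-shⁿ zero    f n = refl
    E-shⁿ (suc k) f n = trans (E-sh (shⁿ k f) n) (sh-cong (E-shⁿ k f) n)

  shⁿ-vanish : ∀ k f n → n < k → shⁿ k f n ≡ + 0
  shⁿ-vanish (suc k) f zero    _         = refl
  shⁿ-vanish (suc k) f (suc n) (s≤s n<k) = shⁿ-vanish k f n n<k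

  -- The factorisation (1 − 2x)² = (1 − x)²(1 − 2x − x²) + x⁴, first as an identity
  -- between the five coefficients f n, …, f (n ∸ 4) it involves, then on sequences.
  factor : ∀ v₀ v₁ v₂ v₃ v₄ →
    v₀ - + 2 * v₁ - + 2 * (v₁ - + 2 * v₂)
      ≡ ((v₀ - + 2 * v₁ - v₂) - (v₁ - + 2 * v₂ - v₃))
        - ((v₁ - + 2 * v₂ - v₃) - (v₂ - + 2 * v₃ - v₄)) + v₄
  factor = solve-∀

  E²-factor : ∀ f n → E² f n ≡ D² (Q f) n + shⁿ 4 f n
  E²-factor f zero                  = factor (f 0) (+ 0) (+ 0) (+ 0) (+ 0)
  E²-factor f (suc zero)            = factor (f 1) (f 0) (+ 0) (+ 0) (+ 0)
  E²-factor f (suc (suc zero))      = factor (f 2) (f 1) (f 0) (+ 0) (+ 0)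
  E²-factor f (suc (suc (suc zero))) = factor (f 3) (f 2) (f 1) (f 0) (+ 0)
  E²-factor f (suc (suc (suc (suc n)))) =
    factor (f (4 ℕ.+ n)) (f (3 ℕ.+ n)) (f (2 ℕ.+ n)) (f (1 ℕ.+ n)) (f n)

  -- E² f = D² g + x⁴ f forces Q f = g, because E² − x⁴ = D² ∘ Q and D is injective.
  Q-from-E² : ∀ {f g} → (∀ n → E² f n ≡ D² g n + shⁿ 4 f n) → Q f ≗ g
  Q-from-E² {f} {g} eq = D-injective (D-injective (λ n →
    ∙-cancelʳ (shⁿ 4 f n) (D² (Q f) n) (D² g n) (trans (sym (E²-factor f n)) (eq n))))

  E²-from : ∀ {f g h} → E f ≗ D g → E g ≗ D h → E² f ≗ D² h
  E²-from {f} {g} eq₁ eq₂ n = trans (E-cong eq₁ n) (trans (sym (DE g n)) (D-cong eq₂ n))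

  Agree : ℕ → Seq → Seq → Set
  Agree n f g = ∀ k → k ≤ n → f k ≡ g k

  sh-agree : ∀ {n f g} → Agree n f g → Agree n (sh f) (sh g)
  sh-agree eq zero    _   = refl
  sh-agree eq (suc k) k<n = eq k (<⇒≤ k<n)

  shⁿ-agree : ∀ k {n f g} → Agree n f g → Agree n (shⁿ k f) (shⁿ k g)
  shⁿ-agree zero    eq = eq
  shⁿ-agree (suc k) eq = sh-agree (shⁿ-agree k eq)

  E²-agree : ∀ {n f g} → Agree n f g → Agree n (E² f) (E² g)
  E²-agree eq = E-agree (E-agree eq)
    where
    E-agree : ∀ {n f g} → Agree n f g → Agree n (E f) (E g)
    E-agree eq k k≤n = cong₂ (λ x y → x - + 2 * y) (eq k k≤n) (sh-agree eq k k≤n)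

  ∑Seq : ℕ → (ℕ → Seq) → Seq
  ∑Seq N T n = ∑ℤ< N (λ i → T i n)

  sh-∑ : ∀ N T → sh (∑Seq N T) ≗ ∑Seq N (sh ∘ T)
  sh-∑ N T zero    = sym (∑ℤ<-zero N (λ i → sh (T i) 0) (λ _ → refl))
  sh-∑ N T (suc n) = refl

  shⁿ-∑ : ∀ k N T → shⁿ k (∑Seq N T) ≗ ∑Seq N (shⁿ k ∘ T)
  shⁿ-∑ zero    N T n = refl
  shⁿ-∑ (suc k) N T n = trans (sh-cong (shⁿ-∑ k N T) n) (sh-∑ N (shⁿ k ∘ T) n)

  E²-∑ : ∀ N T → E² (∑Seq N T) ≗ ∑Seq N (E² ∘ T)
  E²-∑ N T n = trans (E-cong (E-∑ N T) n) (E-∑ N (E ∘ T) n)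
    where
    E-∑ : ∀ N T → E (∑Seq N T) ≗ ∑Seq N (E ∘ T)
    E-∑ N T n = trans (cong (λ s → ∑Seq N T n - + 2 * s) (sh-∑ N T n))
      (sym (∑ℤ<-linear N (+ 2) (λ i → T i n) (λ i → sh (T i) n)))

  -- A family is lower triangular if T i vanishes below index i. Its sum ∑ᵢ T i
  -- is then a well-defined series, whose n-th coefficient involves T 0, …, T n.
  LowerTriangular : (ℕ → Seq) → Set
  LowerTriangular T = ∀ i n → n < i → T i n ≡ + 0

  ∑∞ : (ℕ → Seq) → Seq
  ∑∞ T n = ∑Seq (suc n) T n

  ∑Seq-agree : ∀ {T} → LowerTriangular T → ∀ {n N} → n < N → Agree n (∑Seq N T) (∑∞ T)
  ∑Seq-agree {T} low n<N k k≤n =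
    ∑ℤ<-vanish (λ i → T i k) (≤-trans (s≤s k≤n) n<N) (λ i k<i → low i k k<i)

  E²-∑∞ : ∀ {T c} → LowerTriangular T → E² (T 0) ≗ c →
    (∀ i → E² (T (suc i)) ≗ shⁿ 4 (T i)) → ∀ n → E² (∑∞ T) n ≡ c n + shⁿ 4 (∑∞ T) n
  E²-∑∞ {T} {c} low base step n = begin
      E² (∑∞ T) n
    ≡⟨ E²-agree (∑Seq-agree low (n≤1+n (suc n))) n ≤-refl ⟨
      E² (∑Seq (suc (suc n)) T) n
    ≡⟨ E²-∑ (suc (suc n)) T n ⟩
      E² (T 0) n + ∑Seq (suc n) (E² ∘ T ∘ suc) n
    ≡⟨ cong₂ _+_ (base n) (∑ℤ<-cong (suc n) (λ i → step i n)) ⟩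
      c n + ∑Seq (suc n) (shⁿ 4 ∘ T) n
    ≡⟨ cong (λ s → c n + s) (shⁿ-∑ 4 (suc n) T n) ⟨
      c n + shⁿ 4 (∑Seq (suc n) T) n
    ≡⟨ cong (λ s → c n + s) (shⁿ-agree 4 (∑Seq-agree low ≤-refl) n ≤-refl) ⟩
      c n + shⁿ 4 (∑∞ T) n
    ∎

module PellSeries where
  open TilingCounts using (a-red-zero; a-step; a0-step)
  open ShiftOperators
  import Data.Nat as ℕ
  open ℕ using (ℕ; zero; suc; z≤n)
  open import Data.Nat.Properties using (+-identityʳ; *-suc; m≤n*m; <-≤-trans)
  open import Data.Integer using (+_; _+_; _-_; _*_; _⊖_)
  import Data.Integer.Properties as ℤP
  open import Data.Integer.Tactic.RingSolver using (solve-∀)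
  open import Relation.Binary.PropositionalEquality
    using (_≡_; _≗_; refl; sym; trans; cong; subst; module ≡-Reasoning)
  open ≡-Reasoning

  cast-shuffle : ∀ x y z w → x ℕ.+ y ≡ z ℕ.+ 2 ℕ.* w → + x - + 2 * + w ≡ + z - + y
  cast-shuffle x y z w eq = begin
      + x - + 2 * + w
    ≡⟨ add-sub (+ x) (+ y) (+ 2 * + w) ⟩
      + x + + y - + y - + 2 * + w
    ≡⟨ cong (λ s → s - + y - + 2 * + w) (trans (sym (ℤP.pos-+ x y)) (trans (cong +_ eq) cast)) ⟩
      + z + + 2 * + w - + y - + 2 * + w
    ≡⟨ sub-add (+ z) (+ y) (+ 2 * + w) ⟩
      + z - + y
    ∎
    where
    add-sub : ∀ x y u → x - u ≡ x + y - y - u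
    add-sub = solve-∀
    sub-add : ∀ z y u → z + u - y - u ≡ z - y
    sub-add = solve-∀
    cast : + (z ℕ.+ 2 ℕ.* w) ≡ + z + + 2 * + w
    cast = trans (ℤP.pos-+ z (2 ℕ.* w)) (cong (λ s → + z + s) (ℤP.pos-* 2 w))

  A : ℕ → Seq
  A r n = + a r n

  Aₛ : ℕ → ℕ → Seq
  Aₛ s r n = + aₛ s r n

  Aₛ-suc : ∀ s r → Aₛ (suc s) r ≗ Σ (Aₛ s r)
  Aₛ-suc s r n = sum-upTo-ℤ (aₛ s r) (suc n)

  E-A-suc : ∀ r → E (A (suc r)) ≗ D (A r)
  E-A-suc r zero    = cong (λ m → + m - + 0) (a-red-zero r)
  E-A-suc r (suc n) =
    cast-shuffle (a (suc r) (suc n)) (a r n) (a r (suc n)) (a (suc r) n) (a-step r n)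

  E-A-zero : E (A 0) ≗ D δ
  E-A-zero zero          = refl
  E-A-zero (suc zero)    = refl
  E-A-zero (suc (suc n)) = cast-shuffle (a 0 (suc (suc n))) 0 0 (a 0 (suc n))
    (trans (+-identityʳ (a 0 (suc (suc n)))) (a0-step n))

  E²-A : ∀ r → E² (A (suc (suc r))) ≗ D² (A r)
  E²-A r = E²-from {A (suc (suc r))} {A (suc r)} {A r} (E-A-suc (suc r)) (E-A-suc r)

  E²-A₁ : E² (A 1) ≗ D² δ
  E²-A₁ = E²-from {A 1} {A 0} {δ} (E-A-suc 0) E-A-zero

  -- E² a_{s+2}(r+2, ·) = a_s(r, ·): E² commutes with partial summation, and two
  -- partial summations undo D².
  E²-Aₛ : ∀ s r → E² (Aₛ (suc (suc s)) (suc (suc r))) ≗ Aₛ s r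
  E²-Aₛ zero r n = begin
      E² (Aₛ 2 (suc (suc r))) n
    ≡⟨ E²-cong (λ m → trans (Aₛ-suc 1 (suc (suc r)) m) (Σ-cong (Aₛ-suc 0 (suc (suc r))) m)) n ⟩
      E² (Σ (Σ (A (suc (suc r))))) n
    ≡⟨ E²Σ (Σ (A (suc (suc r)))) n ⟩
      Σ (E² (Σ (A (suc (suc r))))) n
    ≡⟨ Σ-cong (E²Σ (A (suc (suc r)))) n ⟩
      Σ (Σ (E² (A (suc (suc r))))) n
    ≡⟨ Σ-cong (Σ-cong (E²-A r)) n ⟩
      Σ (Σ (D² (A r))) n
    ≡⟨ ΣΣD² (A r) n ⟩
      A r n
    ∎
  E²-Aₛ (suc s) r n = begin
      E² (Aₛ (suc (suc (suc s))) (suc (suc r))) n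
    ≡⟨ E²-cong (Aₛ-suc (suc (suc s)) (suc (suc r))) n ⟩
      E² (Σ (Aₛ (suc (suc s)) (suc (suc r)))) n
    ≡⟨ E²Σ (Aₛ (suc (suc s)) (suc (suc r))) n ⟩
      Σ (E² (Aₛ (suc (suc s)) (suc (suc r)))) n
    ≡⟨ Σ-cong (E²-Aₛ s r) n ⟩
      Σ (Aₛ s r) n
    ≡⟨ Aₛ-suc s r n ⟨
      Aₛ (suc s) r n
    ∎

  F : ℕ → Seq
  F i = Aₛ (2 ℕ.* i) (suc (2 ℕ.* i))

  E²-F : ∀ i → E² (F (suc i)) ≗ F i
  E²-F i = subst (λ s → E² (Aₛ s (suc s)) ≗ F i) (sym (*-suc 2 i))
    (E²-Aₛ (2 ℕ.* i) (suc (2 ℕ.* i)))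

  T : ℕ → Seq
  T i n = + aₛℤ (2 ℕ.* i) (suc (2 ℕ.* i)) (+ n - + (4 ℕ.* i))

  T-shifted : ∀ i → T i ≗ shⁿ (4 ℕ.* i) (F i)
  T-shifted i n = trans (cong (λ z → + aₛℤ (2 ℕ.* i) (suc (2 ℕ.* i)) z) (ℤP.m-n≡m⊖n n (4 ℕ.* i)))
    (shifted (4 ℕ.* i) n)
    where
    shifted : ∀ {s r} k n → + aₛℤ s r (n ⊖ k) ≡ shⁿ k (Aₛ s r) n
    shifted {s} {r} zero n = cong (λ z → + aₛℤ s r z) (ℤP.≤-⊖ (z≤n {n}))
    shifted (suc k) zero    = refl
    shifted {s} {r} (suc k) (suc n) =
      trans (cong (λ z → + aₛℤ s r z) (ℤP.[1+m]⊖[1+n]≡m⊖n n k)) (shifted k n)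

  T-lower : LowerTriangular T
  T-lower i n n<i = trans (T-shifted i n) (shⁿ-vanish (4 ℕ.* i) (F i) n (<-≤-trans n<i (m≤n*m i 4)))

  E²-T-zero : E² (T 0) ≗ D² δ
  E²-T-zero n = trans (E²-cong (T-shifted 0) n) (E²-A₁ n)

  E²-T-suc : ∀ i → E² (T (suc i)) ≗ shⁿ 4 (T i)
  E²-T-suc i n = begin
      E² (T (suc i)) n
    ≡⟨ E²-cong (T-shifted (suc i)) n ⟩
      E² (shⁿ (4 ℕ.* suc i) (F (suc i))) n
    ≡⟨ E²-shⁿ (4 ℕ.* suc i) (F (suc i)) n ⟩
      shⁿ (4 ℕ.* suc i) (E² (F (suc i))) n
    ≡⟨ shⁿ-cong (4 ℕ.* suc i) (E²-F i) n ⟩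
      shⁿ (4 ℕ.* suc i) (F i) n
    ≡⟨ cong (λ k → shⁿ k (F i) n) (*-suc 4 i) ⟩
      shⁿ 4 (shⁿ (4 ℕ.* i) (F i)) n
    ≡⟨ shⁿ-cong 4 (λ m → sym (T-shifted i m)) n ⟩
      shⁿ 4 (T i) n
    ∎

  Pell : Seq
  Pell n = + P (suc n)

  Q-Pell : Q Pell ≗ δ
  Q-Pell zero          = refl
  Q-Pell (suc zero)    = refl
  Q-Pell (suc (suc n)) = begin
      + (2 ℕ.* x ℕ.+ y) - + 2 * + x - + y
    ≡⟨ cong (λ s → s - + 2 * + x - + y)
         (trans (ℤP.pos-+ (2 ℕ.* x) y) (cong (λ s → s + + y) (ℤP.pos-* 2 x))) ⟩
      + 2 * + x + + y - + 2 * + x - + y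
    ≡⟨ cancel (+ x) (+ y) ⟩
      + 0
    ∎
    where
    x : ℕ
    x = P (suc (suc n))
    y : ℕ
    y = P (suc n)
    cancel : ∀ x y → + 2 * x + y - + 2 * x - y ≡ + 0
    cancel = solve-∀

  sum-is-Pell : ∑∞ T ≗ Pell
  sum-is-Pell = Q-injective (λ n →
    trans (Q-from-E² {∑∞ T} {δ} (E²-∑∞ {T} {D² δ} T-lower E²-T-zero E²-T-suc) n) (sym (Q-Pell n)))

open import Data.Nat using (ℕ; suc; _*_)
open import Data.Integer using (+_; _-_)
open import Data.Integer.Properties using (+-injective)
open import Data.List using (map; upTo)
open import Data.Nat.ListAction using (sum)
open import Relation.Binary.PropositionalEquality using (_≡_; sym; trans)
open ShiftOperators using (sum-upTo-ℤ)
open PellSeries using (sum-is-Pell)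

mainTheorem20 : (n : ℕ) →
    P (suc n) ≡ sum (map (λ i → aₛℤ (2 * i) (suc (2 * i)) (+ n - + (4 * i))) (upTo (suc n)))
mainTheorem20 n = +-injective (trans (sym (sum-is-Pell n)) (sym (sum-upTo-ℤ _ (suc n))))
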